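{- Let $D$ be a digraph on $\{1,\dots,n\}$, $q\ge 2$, $p\ge 1$ and $f\in F(D,q)$. Then $\operatorname{ima}(f^p)\le\alpha_p(D)$.
   Context: A digraph $D=(V,E)$ has $V=\{1,\dots,n\}$, $E\subseteq V^2$ (loops allowed). A $p$-walk is a sequence $(v_0,\dots,v_p)$ with $(v_s,v_{s+1})\in E$; two $p$-walks $(w_s),(w'_s)$ are independent if $w_s\ne w'_s$ for all $0\le s\le p$; $\alpha_p(D)$ is the maximum number of pairwise independent $p$-walks. Let $[q]=\{0,\dots,q-1\}$. For $f:[q]^n\to[q]^n$, $\mathrm{IG}(f)$ is the digraph on $V$ with $(u,v)$ an arc iff $f_v$ depends essentially on $x_u$; $F(D,q)=\{f:\mathrm{IG}(f)\subseteq D\}$. $f^p$ is the $p$-th iterate of $f$ and $\operatorname{ima}(g)=\log_q|\mathrm{Im}(g)|$. -}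

module Defs where

open import Data.Nat using (ℕ; zero; suc; _≤_; _^_)
open import Data.Fin using (Fin; inject₁) renaming (suc to fsuc)
open import Data.Vec using (Vec; lookup; _[_]≔_)
open import Data.List using (List; length)
open import Data.List.Relation.Unary.All using (All)
open import Data.List.Relation.Unary.Unique.Propositional using (Unique)
open import Data.List.Membership.Propositional using (_∈_)
open import Data.Product using (Σ; ∃; ∃-syntax; _×_)
open import Relation.Binary.PropositionalEquality using (_≡_; _≢_)

-- A digraph on V = Fin n (vertices 0..n-1 stand for 1..n); loops allowed.
Digraph : ℕ → Set₁
Digraph n = Fin n → Fin n → Set

State : ℕ → ℕ → Set
State q n = Vec (Fin q) n

DependsOn : ∀ {q n} → (State q n → State q n) → Fin n → Fin n → Set
DependsOn f u v = ∃[ x ] ∃[ a ] lookup (f x) v ≢ lookup (f (x [ u ]≔ a)) v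

InF : ∀ {n} → Digraph n → (q : ℕ) → (State q n → State q n) → Set
InF D q f = ∀ u v → DependsOn f u v → D u v

iter : ∀ {A : Set} → ℕ → (A → A) → A → A
iter zero    g x = x
iter (suc p) g x = g (iter p g x)

IsWalk : ∀ {n} → Digraph n → (p : ℕ) → (Fin (suc p) → Fin n) → Set
IsWalk D p w = ∀ (s : Fin p) → D (w (inject₁ s)) (w (fsuc s))

Independent : ∀ {n p} → (Fin (suc p) → Fin n) → (Fin (suc p) → Fin n) → Set
Independent w w' = ∀ s → w s ≢ w' s

IndepFamily : ∀ {n} → Digraph n → (p k : ℕ) → Set
IndepFamily {n} D p k =
  Σ (Fin k → Fin (suc p) → Fin n) λ W →
    (∀ i → IsWalk D p (W i)) × (∀ i j → i ≢ j → Independent (W i) (W j))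

IsAlpha : ∀ {n} → Digraph n → (p k : ℕ) → Set
IsAlpha D p k = IndepFamily D p k × (∀ m → IndepFamily D p m → m ≤ k)

ImCard : ∀ {A B : Set} → (A → B) → ℕ → Set
ImCard {A} {B} g c =
  Σ (List B) λ ys → Unique ys × length ys ≡ c ×
    All (λ y → ∃[ x ] g x ≡ y) ys × (∀ x → g x ∈ ys)

-- Unfold f into its time-expanded graph: the vertex (s , u) carries the value of f^s(x) at u,
-- and there is an arc (s , u) → (s + 1 , v) whenever f_v depends on x_u.  Vertex-disjoint paths
-- from layer 0 to layer p are independent p-walks of D, so by Menger's theorem some set Z of at
-- most α_p(D) vertices meets every such path.  Every value of layer p is then determined by the
-- values on Z (a value is determined by those of its in-neighbours, and every backward path from
-- it meets Z), hence f^p takes at most q^|Z| ≤ q^α_p(D) values.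
module Submission where

open import Defs
open import Data.Nat using (ℕ; zero; suc; _+_; _≤_; _≰_; _^_; _≤?_; z≤n; s≤s; >-nonZero)
open import Data.Nat.Properties
  using (≤-refl; ≤-trans; ≰⇒>; suc-injective; ^-monoʳ-≤; +-identityʳ; +-suc; 1+n≰n; module ≤-Reasoning)
import Data.Nat as ℕ
open import Data.Fin using (Fin; toℕ; fromℕ; inject₁; inject≤; punchOut; combine)
  renaming (zero to fzero; suc to fsuc; _≟_ to _≟ᶠ_)
open import Data.Fin.Properties
  using (any?; injective⇒≤; punchOut-injective; inject≤-injective; combine-injective;
         toℕ-inject₁; toℕ-fromℕ; toℕ<n; toℕ≤pred[n]; toℕ-injective)
open import Data.Vec using (Vec; []; _∷_; lookup; _[_]≔_; head; tail)
open import Data.Vec.Properties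
  using (lookup∘update; lookup∘update′; []≔-lookup; tabulate∘lookup; tabulate-cong)
open import Data.List as List
  using (List; []; _∷_; length; foldr; filter; allFin; cartesianProduct; cartesianProductWith)
open import Data.List.Relation.Unary.Any as Any using (Any; here; there; index)
open import Data.List.Relation.Unary.Any.Properties using (lookup-index)
import Data.List.Relation.Unary.All as All
open import Data.List.Relation.Unary.AllPairs using (_∷_)
open import Data.List.Relation.Unary.Unique.Propositional using (Unique)
open import Data.List.Relation.Unary.Unique.Propositional.Properties using (filter⁺; cartesianProduct⁺; allFin⁺)
open import Data.List.Relation.Binary.Disjoint.Propositional using (Disjoint)
open import Data.List.Relation.Binary.Subset.Propositional using (_⊆_)
open import Data.List.Relation.Binary.Subset.Propositional.Properties using (Any-resp-⊆)
open import Data.List.Membership.Propositional using (_∈_; _∉_; find; lose)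
open import Data.List.Membership.Propositional.Properties
  using (∈-lookup; ∈-filter⁻; ∈-filter⁺; ∈-allFin; ∈-cartesianProduct⁺; ∈-cartesianProductWith⁺)
open import Data.Product using (Σ; ∃; ∃₂; _×_; _,_; proj₁; proj₂)
open import Data.Product.Properties using (≡-dec)
open import Data.Sum as Sum using (_⊎_; inj₁; inj₂; [_,_])
open import Data.Empty using (⊥-elim)
open import Function using (_∘_; id)
open import Function.Definitions using (Injective)
open import Relation.Nullary using (¬_; Dec; yes; no; ¬?)
open import Relation.Nullary.Decidable using (_×-dec_; map′; decidable-stable)
open import Relation.Unary using (Decidable)
open import Relation.Binary using (DecidableEquality)
open import Relation.Binary.PropositionalEquality
  using (_≡_; _≢_; refl; sym; trans; cong; cong₂; subst; module ≡-Reasoning)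
open import Relation.Binary.Construct.Closure.ReflexiveTransitive as Star using (Star; ε; _◅_; _◅◅_)

Unique⇒lookup-injective : ∀ {A : Set} {xs : List A} → Unique xs → Injective _≡_ _≡_ (List.lookup xs)
Unique⇒lookup-injective (_ ∷ _)       {fzero}  {fzero}  _  = refl
Unique⇒lookup-injective (x∉xs ∷ _)    {fzero}  {fsuc j} eq = ⊥-elim (All.lookup x∉xs (∈-lookup j) eq)
Unique⇒lookup-injective (x∉xs ∷ _)    {fsuc i} {fzero}  eq = ⊥-elim (All.lookup x∉xs (∈-lookup i) (sym eq))
Unique⇒lookup-injective (_ ∷ unique) {fsuc i} {fsuc j} eq = cong fsuc (Unique⇒lookup-injective unique eq)

injective⇒surjective : ∀ {L} (f : Fin L → Fin L) → Injective _≡_ _≡_ f → ∀ t → ∃ λ j → f j ≡ t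
injective⇒surjective {suc L} f f-injective t with any? (λ j → f j ≟ᶠ t)
... | yes hit = hit
... | no miss = ⊥-elim (1+n≰n (injective⇒≤ {f = squeeze} squeeze-injective))
  where
  t≢f : ∀ j → t ≢ f j
  t≢f j t≡fj = miss (j , sym t≡fj)
  squeeze : Fin (suc L) → Fin L
  squeeze j = punchOut (t≢f j)
  squeeze-injective : Injective _≡_ _≡_ squeeze
  squeeze-injective {i} {j} = f-injective ∘ punchOut-injective (t≢f i) (t≢f j)

lookup-ext : ∀ {A : Set} {m} (xs ys : Vec A m) → (∀ i → lookup xs i ≡ lookup ys i) → xs ≡ ys
lookup-ext xs ys eq = trans (sym (tabulate∘lookup xs)) (trans (tabulate-cong eq) (tabulate∘lookup ys))

allVecs : ∀ q n → List (Vec (Fin q) n)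
allVecs q zero    = [] ∷ []
allVecs q (suc n) = cartesianProductWith _∷_ (allFin q) (allVecs q n)

∈-allVecs : ∀ {q n} (xs : Vec (Fin q) n) → xs ∈ allVecs q n
∈-allVecs []       = here refl
∈-allVecs (x ∷ xs) = ∈-cartesianProductWith⁺ _∷_ (∈-allFin x) (∈-allVecs xs)

encode : ∀ {q m} → Vec (Fin q) m → Fin (q ^ m)
encode []       = fzero
encode (x ∷ xs) = combine x (encode xs)

encode-injective : ∀ {q m} → Injective _≡_ _≡_ (encode {q} {m})
encode-injective {x = []}     {[]}     _  = refl
encode-injective {x = x ∷ xs} {y ∷ ys} eq =
  let x≡y , code≡code = combine-injective x (encode xs) y (encode ys) eq
  in cong₂ _∷_ x≡y (encode-injective code≡code)

ImCard≤^ : ∀ {A B : Set} {g : A → B} {q m c} (code : A → Vec (Fin q) m) →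
  (∀ {x x'} → code x ≡ code x' → g x ≡ g x') → ImCard g c → c ≤ q ^ m
ImCard≤^ {A} {g = g} code determines (ys , ys-unique , refl , ys⊆image , _) =
  injective⇒≤ {f = encode ∘ code ∘ preimage} preimage-code-injective
  where
  preimage : Fin (length ys) → A
  preimage i = proj₁ (All.lookup ys⊆image (∈-lookup i))
  preimage-code-injective : Injective _≡_ _≡_ (encode ∘ code ∘ preimage)
  preimage-code-injective {i} {j} eq = Unique⇒lookup-injective ys-unique (begin
    List.lookup ys i  ≡⟨ proj₂ (All.lookup ys⊆image (∈-lookup i)) ⟨
    g (preimage i)    ≡⟨ determines (encode-injective eq) ⟩
    g (preimage j)    ≡⟨ proj₂ (All.lookup ys⊆image (∈-lookup j)) ⟩
    List.lookup ys j  ∎)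
    where open ≡-Reasoning

module _ {q n : ℕ} (f : State q n → State q n) where

  DependsOn? : ∀ u v → Dec (DependsOn f u v)
  DependsOn? u v =
    map′ (λ found → let x , _ , change = find found in x , change)
         (λ (x , change) → lose (∈-allVecs x) change)
         (Any.any? (λ x → any? λ a → ¬? (lookup (f x) v ≟ᶠ lookup (f (x [ u ]≔ a)) v)) (allVecs q n))

  -- Copy the coordinates of b into a one at a time.  Every intermediate state is a mixture of a
  -- and b, so copying coordinate u can only change output v if u is a dependency of v, where a
  -- and b agree and the copy changes nothing.
  module _ (v : Fin n) (a b : State q n) (agree : ∀ u → DependsOn f u v → lookup a u ≡ lookup b u) where

    private
      Mixture : State q n → Set
      Mixture c = ∀ w → lookup c w ≡ lookup a w ⊎ lookup c w ≡ lookup b w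

      copy : Fin n → State q n → State q n
      copy u c = c [ u ]≔ lookup b u

      copy-Mixture : ∀ u {c} → Mixture c → Mixture (copy u c)
      copy-Mixture u {c} mixture w with w ≟ᶠ u
      ... | yes refl = inj₂ (lookup∘update w c (lookup b w))
      ... | no w≢u   = let c≡c[u] = lookup∘update′ w≢u c _ in Sum.map (trans c≡c[u]) (trans c≡c[u]) (mixture w)

      copy-output : ∀ u {c} → Mixture c → lookup (f c) v ≡ lookup (f (copy u c)) v
      copy-output u {c} mixture with lookup (f c) v ≟ᶠ lookup (f (copy u c)) v
      ... | yes same  = same
      ... | no differ = ⊥-elim (differ (cong (λ d → lookup (f d) v) (sym copy-idle)))
        where
        c≡b-at-u : lookup c u ≡ lookup b u
        c≡b-at-u = [ (λ c≡a → trans c≡a (agree u (c , lookup b u , differ))) , id ] (mixture u)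
        copy-idle : copy u c ≡ c
        copy-idle = trans (cong (c [ u ]≔_) (sym c≡b-at-u)) ([]≔-lookup c u)

      copyAll : List (Fin n) → State q n
      copyAll = foldr copy a

      copyAll-Mixture : ∀ us → Mixture (copyAll us)
      copyAll-Mixture []       w = inj₁ refl
      copyAll-Mixture (u ∷ us)   = copy-Mixture u {copyAll us} (copyAll-Mixture us)

      copyAll-output : ∀ us → lookup (f a) v ≡ lookup (f (copyAll us)) v
      copyAll-output []       = refl
      copyAll-output (u ∷ us) = trans (copyAll-output us) (copy-output u (copyAll-Mixture us))

      copyAll-copies : ∀ {us w} → w ∈ us → lookup (copyAll us) w ≡ lookup b w
      copyAll-copies {u ∷ us} {w} w∈ with w ≟ᶠ u
      ... | yes refl = lookup∘update w (copyAll us) (lookup b w)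
      ... | no w≢u   = trans (lookup∘update′ w≢u (copyAll us) _) (copyAll-copies (Any.tail w≢u w∈))

    dependencies-determine : lookup (f a) v ≡ lookup (f b) v
    dependencies-determine = trans (copyAll-output (allFin n))
      (cong (λ d → lookup (f d) v) (lookup-ext _ _ λ w → copyAll-copies (∈-allFin w)))

-- Menger's theorem for finite digraphs

module Menger {V : Set} (_≟_ : DecidableEquality V)
    (enum : List V) (enum-unique : Unique enum) (∈-enum : ∀ v → v ∈ enum) where

  open import Data.List.Membership.DecPropositional _≟_ using (_∈?_)

  Graph : Set
  Graph = List (V × V)

  Walk : Graph → V → V → Set
  Walk G = Star (λ x y → (x , y) ∈ G)

  private
    variable
      G : Graph
      a b c x y : V
      A B : V → Set

  verts : Walk G a b → List V
  verts {a = a} ε       = a ∷ []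
  verts {a = a} (_ ◅ w) = a ∷ verts w

  initVerts : Walk G a b → List V
  initVerts ε               = []
  initVerts {a = a} (_ ◅ w) = a ∷ initVerts w

  tailVerts : Walk G a b → List V
  tailVerts ε       = []
  tailVerts (_ ◅ w) = verts w

  start∈verts : (w : Walk G a b) → a ∈ verts w
  start∈verts ε       = here refl
  start∈verts (_ ◅ w) = here refl

  end∈verts : (w : Walk G a b) → b ∈ verts w
  end∈verts ε       = here refl
  end∈verts (_ ◅ w) = there (end∈verts w)

  initVerts⊆verts : (w : Walk G a b) → initVerts w ⊆ verts w
  initVerts⊆verts ε ()
  initVerts⊆verts (_ ◅ w) (here refl) = here refl
  initVerts⊆verts (_ ◅ w) (there v∈) = there (initVerts⊆verts w v∈)

  tailVerts⊆verts : (w : Walk G a b) → tailVerts w ⊆ verts w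
  tailVerts⊆verts ε       ()
  tailVerts⊆verts (_ ◅ w) = there

  ∈verts⇒∈initVerts⊎≡end : ∀ {v} (w : Walk G a b) → v ∈ verts w → v ∈ initVerts w ⊎ v ≡ b
  ∈verts⇒∈initVerts⊎≡end ε       (here refl) = inj₂ refl
  ∈verts⇒∈initVerts⊎≡end (_ ◅ w) (here refl) = inj₁ (here refl)
  ∈verts⇒∈initVerts⊎≡end (_ ◅ w) (there v∈) = Sum.map₁ there (∈verts⇒∈initVerts⊎≡end w v∈)

  ∈verts⇒≡start⊎∈tailVerts : ∀ {v} (w : Walk G a b) → v ∈ verts w → v ≡ a ⊎ v ∈ tailVerts w
  ∈verts⇒≡start⊎∈tailVerts ε       (here refl) = inj₁ refl
  ∈verts⇒≡start⊎∈tailVerts (_ ◅ w) (here refl) = inj₁ refl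
  ∈verts⇒≡start⊎∈tailVerts (_ ◅ w) (there v∈) = inj₂ v∈

  ∈verts-◅◅ : ∀ {v} (w₁ : Walk G a b) (w₂ : Walk G b c) →
    v ∈ verts (w₁ ◅◅ w₂) → v ∈ initVerts w₁ ⊎ v ∈ verts w₂
  ∈verts-◅◅ ε        w₂ v∈          = inj₂ v∈
  ∈verts-◅◅ (_ ◅ w₁) w₂ (here refl) = inj₁ (here refl)
  ∈verts-◅◅ (_ ◅ w₁) w₂ (there v∈)  = Sum.map₁ there (∈verts-◅◅ w₁ w₂ v∈)

  Any-verts-snoc : ∀ {P : V → Set} (w : Walk G a b) (e : (b , c) ∈ G) →
    Any P (verts (w ◅◅ e ◅ ε)) → ¬ P c → Any P (verts w)
  Any-verts-snoc ε        e (here pb)         _   = here pb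
  Any-verts-snoc ε        e (there (here pc)) ¬pc = ⊥-elim (¬pc pc)
  Any-verts-snoc (_ ◅ w)  e (here pa)         _   = here pa
  Any-verts-snoc (_ ◅ w)  e (there hit)       ¬pc = there (Any-verts-snoc w e hit ¬pc)

  len : Walk G a b → ℕ
  len ε       = 0
  len (_ ◅ w) = suc (len w)

  at : Walk G a b → ℕ → V
  at {a = a} ε       j       = a
  at {a = a} (_ ◅ w) zero    = a
  at         (_ ◅ w) (suc j) = at w j

  at∈verts : ∀ (w : Walk G a b) j → at w j ∈ verts w
  at∈verts ε       j       = here refl
  at∈verts (_ ◅ w) zero    = here refl
  at∈verts (_ ◅ w) (suc j) = there (at∈verts w j)

  at-len : (w : Walk G a b) → at w (len w) ≡ b
  at-len ε       = refl
  at-len (_ ◅ w) = at-len w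

  at-arc : ∀ (w : Walk G a b) j → suc j ≤ len w → (at w j , at w (suc j)) ∈ G
  at-arc ε             _       ()
  at-arc (e ◅ ε)       zero    _           = e
  at-arc (e ◅ (_ ◅ _)) zero    _           = e
  at-arc (_ ◅ w)       (suc j) (s≤s j<len) = at-arc w j j<len

  splitAt : ∀ {z} (w : Walk G a b) → z ∈ verts w →
    ∃₂ λ (w₁ : Walk G a z) (w₂ : Walk G z b) → initVerts w₁ ⊆ initVerts w × tailVerts w₂ ⊆ tailVerts w
  splitAt ε       (here refl) = ε , ε , id , id
  splitAt (e ◅ w) (here refl) = ε , e ◅ w , (λ ()) , id
  splitAt (e ◅ w) (there z∈) =
    let w₁ , w₂ , init⊆ , tail⊆ = splitAt w z∈
    in e ◅ w₁ , w₂ , (λ { (here refl) → here refl ; (there v∈) → there (init⊆ v∈) }) ,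
       tailVerts⊆verts w ∘ tail⊆

  lift : ∀ e → Walk G a b → Walk (e ∷ G) a b
  lift e = Star.map there

  verts-lift : ∀ e (w : Walk G a b) → verts (lift e w) ≡ verts w
  verts-lift e ε       = refl
  verts-lift e (_ ◅ w) = cong (_ ∷_) (verts-lift e w)

  initVerts-lift⊆verts : ∀ e (w : Walk G a b) → initVerts (lift e w) ⊆ verts w
  initVerts-lift⊆verts e w = subst (_ ∈_) (verts-lift e w) ∘ initVerts⊆verts (lift e w)

  strengthenˡ : (w : Walk ((x , y) ∷ G) a b) →
    x ∈ initVerts w ⊎ ∃ λ (w' : Walk G a b) → verts w' ≡ verts w
  strengthenˡ ε               = inj₂ (ε , refl)
  strengthenˡ (here refl ◅ w) = inj₁ (here refl)
  strengthenˡ (there e ◅ w)   = Sum.map there (λ (w' , eq) → e ◅ w' , cong (_ ∷_) eq) (strengthenˡ w)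

  strengthenʳ : (w : Walk ((x , y) ∷ G) a b) →
    y ∈ tailVerts w ⊎ ∃ λ (w' : Walk G a b) → verts w' ≡ verts w
  strengthenʳ ε               = inj₂ (ε , refl)
  strengthenʳ (here refl ◅ w) = inj₁ (start∈verts w)
  strengthenʳ (there e ◅ w)   =
    Sum.map (tailVerts⊆verts w) (λ (w' , eq) → e ◅ w' , cong (_ ∷_) eq) (strengthenʳ w)

  record FirstHit (G : Graph) (P : V → Set) (a : V) (vs : List V) : Set where
    field
      hit     : V
      hit∈P   : P hit
      prefix  : Walk G a hit
      misses  : ∀ {v} → v ∈ initVerts prefix → ¬ P v
      prefix⊆ : verts prefix ⊆ vs

  firstHit : ∀ {P : V → Set} → Decidable P → (w : Walk G a b) → Any P (verts w) → FirstHit G P a (verts w)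
  firstHit {a = a} P? w hits with P? a
  firstHit {a = a} P? w hits | yes pa =
    record { hit = a ; hit∈P = pa ; prefix = ε ; misses = λ ()
           ; prefix⊆ = λ { (here refl) → start∈verts w } }
  firstHit P? ε (here pa) | no ¬pa = ⊥-elim (¬pa pa)
  firstHit {a = a} P? (e ◅ w) hits | no ¬pa = record
    { hit     = hit
    ; hit∈P   = hit∈P
    ; prefix  = e ◅ prefix
    ; misses  = λ { (here refl) → ¬pa ; (there v∈) → misses v∈ }
    ; prefix⊆ = λ { (here refl) → here refl ; (there v∈) → there (prefix⊆ v∈) }
    }
    where open FirstHit (firstHit P? w (Any.tail ¬pa hits))

  record LastHit (G : Graph) (P : V → Set) (b : V) (vs : List V) : Set where
    field
      hit     : V
      hit∈P   : P hit
      suffix  : Walk G hit b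
      misses  : ∀ {v} → v ∈ tailVerts suffix → ¬ P v
      suffix⊆ : verts suffix ⊆ vs

  lastHit : ∀ {P : V → Set} → Decidable P → (w : Walk G a b) → Any P (verts w) → LastHit G P b (verts w)
  lastHit P? ε (here pa) = record { hit = _ ; hit∈P = pa ; suffix = ε ; misses = λ () ; suffix⊆ = id }
  lastHit P? (e ◅ w) hits with Any.any? P? (verts w)
  ... | yes later =
    record { hit = hit ; hit∈P = hit∈P ; suffix = suffix ; misses = misses ; suffix⊆ = there ∘ suffix⊆ }
    where open LastHit (lastHit P? w later)
  ... | no ¬later = record
    { hit = _ ; hit∈P = Any.head ¬later hits ; suffix = e ◅ w
    ; misses = λ v∈ pv → ¬later (lose v∈ pv) ; suffix⊆ = id }

  record Path (G : Graph) (A B : V → Set) : Set where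
    field
      source target : V
      source∈A : A source
      target∈B : B target
      walk     : Walk G source target

  open Path public

  DisjointPaths : Graph → (V → Set) → (V → Set) → ℕ → Set
  DisjointPaths G A B m = Σ (Fin m → Path G A B) λ W →
    ∀ {i j} → i ≢ j → Disjoint (verts (walk (W i))) (verts (walk (W j)))

  Separates : Graph → (V → Set) → (V → Set) → List V → Set
  Separates G A B Z = ∀ {a b} → A a → B b → (w : Walk G a b) → Any (_∈ Z) (verts w)

  shared⇒≡ : ∀ {m} ((W , _) : DisjointPaths G A B m) {i j v} →
    v ∈ verts (walk (W i)) → v ∈ verts (walk (W j)) → i ≡ j
  shared⇒≡ (_ , disjoint) {i} {j} v∈i v∈j =
    decidable-stable (i ≟ᶠ j) λ i≢j → disjoint i≢j (v∈i , v∈j)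

  takePaths : ∀ {k m} → m ≤ k → DisjointPaths G A B k → DisjointPaths G A B m
  takePaths m≤k (W , disjoint) =
    (λ i → W (inject≤ i m≤k)) , λ i≢j → disjoint (i≢j ∘ inject≤-injective _ _ _ _)

  liftPaths : ∀ {e m} → DisjointPaths G A B m → DisjointPaths (e ∷ G) A B m
  liftPaths {e = e} (W , disjoint) = liftPath ∘ W , λ {i} {j} i≢j (v∈i , v∈j) →
    disjoint i≢j (subst (_ ∈_) (verts-lift e (walk (W i))) v∈i , subst (_ ∈_) (verts-lift e (walk (W j))) v∈j)
    where
    liftPath : Path _ _ _ → Path _ _ _
    liftPath p = record { source∈A = source∈A p ; target∈B = target∈B p ; walk = lift e (walk p) }

  separates-⊆ : ∀ {Z Z'} → Z ⊆ Z' → Separates G A B Z → Separates G A B Z'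
  separates-⊆ Z⊆Z' separates a∈A b∈B w = Any.map Z⊆Z' (separates a∈A b∈B w)

  separates-newArcˡ : ∀ {Z} → x ∈ Z → Separates G A B Z → Separates ((x , y) ∷ G) A B Z
  separates-newArcˡ x∈Z separates a∈A b∈B w with strengthenˡ w
  ... | inj₁ x∈w        = lose (initVerts⊆verts w x∈w) x∈Z
  ... | inj₂ (w' , eq) = subst (Any (_∈ _)) eq (separates a∈A b∈B w')

  separates-newArcʳ : ∀ {Z} → y ∈ Z → Separates G A B Z → Separates ((x , y) ∷ G) A B Z
  separates-newArcʳ y∈Z separates a∈A b∈B w with strengthenʳ w
  ... | inj₁ y∈w        = lose (tailVerts⊆verts w y∈w) y∈Z
  ... | inj₂ (w' , eq) = subst (Any (_∈ _)) eq (separates a∈A b∈B w')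

  -- Cut an A–B walk at its first vertex in X: the prefix reaches X without passing x, so it
  -- avoids the new arc.
  separates-transˡ : ∀ {X Z} → x ∈ X → Separates ((x , y) ∷ G) A B X → Separates G A (_∈ X) Z →
    Separates ((x , y) ∷ G) A B Z
  separates-transˡ {X = X} {Z} x∈X X-separates Z-separates a∈A b∈B w
    with firstHit (_∈? X) w (X-separates a∈A b∈B w)
  ... | h with strengthenˡ (FirstHit.prefix h)
  ...   | inj₁ x∈prefix = ⊥-elim (FirstHit.misses h x∈prefix x∈X)
  ...   | inj₂ (w' , eq) =
    Any-resp-⊆ (FirstHit.prefix⊆ h) (subst (Any (_∈ Z)) eq (Z-separates a∈A (FirstHit.hit∈P h) w'))

  separates-transʳ : ∀ {Y Z} → y ∈ Y → Separates ((x , y) ∷ G) A B Y → Separates G (_∈ Y) B Z →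
    Separates ((x , y) ∷ G) A B Z
  separates-transʳ {Y = Y} {Z} y∈Y Y-separates Z-separates a∈A b∈B w
    with lastHit (_∈? Y) w (Y-separates a∈A b∈B w)
  ... | h with strengthenʳ (LastHit.suffix h)
  ...   | inj₁ y∈suffix = ⊥-elim (LastHit.misses h y∈suffix y∈Y)
  ...   | inj₂ (w' , eq) =
    Any-resp-⊆ (LastHit.suffix⊆ h) (subst (Any (_∈ Z)) eq (Z-separates (LastHit.hit∈P h) b∈B w'))

  record Certificate (G : Graph) (A B : V → Set) : Set where
    field
      size           : ℕ
      paths          : DisjointPaths G A B size
      separator      : List V
      separator-size : length separator ≤ size
      separates      : Separates G A B separator

  open Certificate

  keepPaths : ∀ {e} (M : Certificate G A B) Z → length Z ≤ size M → Separates (e ∷ G) A B Z →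
    Certificate (e ∷ G) A B
  keepPaths M Z Z≤size Z-separates = record
    { size = size M ; paths = liftPaths (paths M)
    ; separator = Z ; separator-size = Z≤size ; separates = Z-separates }

  -- The new arc x → y, with x , y ∉ S: |S| + 1 disjoint A–(x ∷ S) paths and |S| + 1 disjoint
  -- (y ∷ S)–B paths are cut at their first and last visits to x ∷ S and y ∷ S, and the pieces are
  -- glued at the common vertices of S, resp. across the arc.
  module Glue {G : Graph} {x y : V} {A B : V → Set} {S : List V}
      (x∉S : x ∉ S) (y∉S : y ∉ S) (S-separates : Separates G A B S)
      (W₁ : DisjointPaths G A (_∈ x ∷ S) (suc (length S)))
      (W₂ : DisjointPaths G (_∈ y ∷ S) B (suc (length S))) where

    L : ℕ
    L = suc (length S)

    X Y : List V
    X = x ∷ S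
    Y = y ∷ S

    P : ∀ i → FirstHit G (_∈ X) (source (proj₁ W₁ i)) (verts (walk (proj₁ W₁ i)))
    P i = let w = walk (proj₁ W₁ i) in firstHit (_∈? X) w (lose (end∈verts w) (target∈B (proj₁ W₁ i)))

    Q : ∀ j → LastHit G (_∈ Y) (target (proj₁ W₂ j)) (verts (walk (proj₁ W₂ j)))
    Q j = let w = walk (proj₁ W₂ j) in lastHit (_∈? Y) w (lose (start∈verts w) (source∈A (proj₁ W₂ j)))

    open FirstHit using (prefix; prefix⊆)
    open LastHit using (suffix; suffix⊆)

    end : Fin L → V
    end i = FirstHit.hit (P i)

    start : Fin L → V
    start j = LastHit.hit (Q j)

    prefix-shared⇒≡ : ∀ {i j v} → v ∈ verts (prefix (P i)) → v ∈ verts (prefix (P j)) → i ≡ j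
    prefix-shared⇒≡ {i} {j} v∈i v∈j = shared⇒≡ W₁ (prefix⊆ (P i) v∈i) (prefix⊆ (P j) v∈j)

    suffix-shared⇒≡ : ∀ {i j v} → v ∈ verts (suffix (Q i)) → v ∈ verts (suffix (Q j)) → i ≡ j
    suffix-shared⇒≡ {i} {j} v∈i v∈j = shared⇒≡ W₂ (suffix⊆ (Q i) v∈i) (suffix⊆ (Q j) v∈j)

    end-injective : Injective _≡_ _≡_ end
    end-injective {i} {j} eq =
      prefix-shared⇒≡ (end∈verts (prefix (P i))) (subst (_∈ _) (sym eq) (end∈verts (prefix (P j))))

    -- Otherwise prefix and suffix would combine into an A–B walk of G avoiding S.
    meet∈S : ∀ {i j z} → z ∈ verts (prefix (P i)) → z ∈ verts (suffix (Q j)) → z ∈ S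
    meet∈S {i} {j} {z} z∈P z∈Q with z ∈? S
    ... | yes z∈S = z∈S
    ... | no z∉S =
      let w₁ , _ , init⊆ , _ = splitAt (prefix (P i)) z∈P
          _ , w₂ , _ , tail⊆ = splitAt (suffix (Q j)) z∈Q
          v , v∈w , v∈S =
            find (S-separates (source∈A (proj₁ W₁ i)) (target∈B (proj₁ W₂ j)) (w₁ ◅◅ w₂))
      in ⊥-elim (avoids w₁ w₂ init⊆ tail⊆ v∈w v∈S)
      where
      avoids : ∀ {a b} (w₁ : Walk G a z) (w₂ : Walk G z b) → initVerts w₁ ⊆ initVerts (prefix (P i)) →
        tailVerts w₂ ⊆ tailVerts (suffix (Q j)) → ∀ {v} → v ∈ verts (w₁ ◅◅ w₂) → v ∉ S
      avoids w₁ w₂ init⊆ tail⊆ v∈w v∈S with ∈verts-◅◅ w₁ w₂ v∈w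
      ... | inj₁ v∈w₁ = FirstHit.misses (P i) (init⊆ v∈w₁) (there v∈S)
      ... | inj₂ v∈w₂ with ∈verts⇒≡start⊎∈tailVerts w₂ v∈w₂
      ...   | inj₁ refl   = z∉S v∈S
      ...   | inj₂ v∈tail = LastHit.misses (Q j) (tail⊆ v∈tail) (there v∈S)

    meet-at-junction : ∀ {i j z} → z ∈ verts (prefix (P i)) → z ∈ verts (suffix (Q j)) →
      z ∈ S × z ≡ end i × z ≡ start j
    meet-at-junction {i} {j} z∈P z∈Q with meet∈S z∈P z∈Q
    ... | z∈S
      with ∈verts⇒∈initVerts⊎≡end (prefix (P i)) z∈P | ∈verts⇒≡start⊎∈tailVerts (suffix (Q j)) z∈Q
    ...   | inj₁ z∈init | _           = ⊥-elim (FirstHit.misses (P i) z∈init (there z∈S))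
    ...   | inj₂ _      | inj₂ z∈tail = ⊥-elim (LastHit.misses (Q j) z∈tail (there z∈S))
    ...   | inj₂ z≡end  | inj₁ z≡start = z∈S , z≡end , z≡start

    -- The L suffixes start at distinct vertices of the L-element list Y, so they start at all of them.
    startingAt : ∀ {t} → t ∈ Y → ∃ λ j → start j ≡ t
    startingAt {t} t∈Y =
      let j , eq = injective⇒surjective position position-injective (index t∈Y)
      in j , trans (lookup-index (LastHit.hit∈P (Q j))) (trans (cong (List.lookup Y) eq) (sym (lookup-index t∈Y)))
      where
      position : Fin L → Fin L
      position j = index (LastHit.hit∈P (Q j))
      position-injective : Injective _≡_ _≡_ position
      position-injective {i} {j} eq = suffix-shared⇒≡ (start∈verts (suffix (Q i)))
        (subst (_∈ _) (trans (lookup-index (LastHit.hit∈P (Q j))) (trans (cong (List.lookup Y) (sym eq))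
          (sym (lookup-index (LastHit.hit∈P (Q i)))))) (start∈verts (suffix (Q j))))

    Continues : Fin L → Fin L → Set
    Continues i j = (end i ≡ x × start j ≡ y) ⊎ (end i ∈ S × start j ≡ end i)

    partner : ∀ i → ∃ (Continues i)
    partner i with FirstHit.hit∈P (P i)
    ... | here end≡x = let j , eq = startingAt (here refl) in j , inj₁ (end≡x , eq)
    ... | there end∈S = let j , eq = startingAt (there end∈S) in j , inj₂ (end∈S , eq)

    Continues-injective : ∀ {i i' j} → Continues i j → Continues i' j → i ≡ i'
    Continues-injective (inj₁ (end≡x , _)) (inj₁ (end'≡x , _)) = end-injective (trans end≡x (sym end'≡x))
    Continues-injective (inj₁ (_ , start≡y)) (inj₂ (end'∈S , start≡end')) =
      ⊥-elim (y∉S (subst (_∈ S) (trans (sym start≡end') start≡y) end'∈S))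
    Continues-injective (inj₂ (end∈S , start≡end)) (inj₁ (_ , start≡y)) =
      ⊥-elim (y∉S (subst (_∈ S) (trans (sym start≡end) start≡y) end∈S))
    Continues-injective (inj₂ (_ , start≡end)) (inj₂ (_ , start≡end')) =
      end-injective (trans (sym start≡end) start≡end')

    glue : ∀ i j → Continues i j → Walk ((x , y) ∷ G) (source (proj₁ W₁ i)) (target (proj₁ W₂ j))
    glue i j (inj₁ (end≡x , start≡y)) =
      lift _ (prefix (P i)) ◅◅ here (cong₂ _,_ end≡x start≡y) ◅ lift _ (suffix (Q j))
    glue i j (inj₂ (_ , start≡end)) =
      lift _ (prefix (P i)) ◅◅ subst (λ s → Walk _ s _) start≡end (lift _ (suffix (Q j)))

    glue-verts : ∀ i j (c : Continues i j) {v} → v ∈ verts (glue i j c) →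
      v ∈ verts (prefix (P i)) ⊎ v ∈ verts (suffix (Q j))
    glue-verts i j (inj₁ _) v∈ with ∈verts-◅◅ (lift _ (prefix (P i))) _ v∈
    ... | inj₁ v∈init             = inj₁ (initVerts-lift⊆verts _ (prefix (P i)) v∈init)
    ... | inj₂ (here refl)        = inj₁ (end∈verts (prefix (P i)))
    ... | inj₂ (there v∈suffix)   = inj₂ (subst (_ ∈_) (verts-lift _ (suffix (Q j))) v∈suffix)
    glue-verts i j (inj₂ (_ , start≡end)) v∈ with ∈verts-◅◅ (lift _ (prefix (P i))) _ v∈
    ... | inj₁ v∈init   = inj₁ (initVerts-lift⊆verts _ (prefix (P i)) v∈init)
    ... | inj₂ v∈suffix =
      inj₂ (subst (_ ∈_) (verts-lift _ (suffix (Q j))) (verts-subst start≡end _ v∈suffix))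
      where
      verts-subst : ∀ {s s' t} (eq : s ≡ s') (w : Walk ((x , y) ∷ G) s t) →
        verts (subst (λ s → Walk _ s _) eq w) ⊆ verts w
      verts-subst refl w = id

    prefix-meets-partner : ∀ {i i' v} →
      v ∈ verts (prefix (P i)) → v ∈ verts (suffix (Q (proj₁ (partner i')))) → i ≡ i'
    prefix-meets-partner {i} {i'} v∈P v∈Q with meet-at-junction v∈P v∈Q | proj₂ (partner i')
    ... | v∈S , _ , v≡start | inj₁ (_ , start≡y) =
      ⊥-elim (y∉S (subst (_∈ S) (trans v≡start start≡y) v∈S))
    ... | _ , v≡end , v≡start | inj₂ (_ , start≡end') =
      end-injective (trans (sym v≡end) (trans v≡start start≡end'))

    gluedPaths : DisjointPaths ((x , y) ∷ G) A B L
    gluedPaths = glued , disjoint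
      where
      glued : Fin L → Path ((x , y) ∷ G) A B
      glued i = let j , c = partner i in record
        { source∈A = source∈A (proj₁ W₁ i) ; target∈B = target∈B (proj₁ W₂ j) ; walk = glue i j c }
      disjoint : ∀ {i j} → i ≢ j → Disjoint (verts (walk (glued i))) (verts (walk (glued j)))
      disjoint {i} {j} i≢j (v∈i , v∈j)
        with glue-verts i _ (proj₂ (partner i)) v∈i | glue-verts j _ (proj₂ (partner j)) v∈j
      ... | inj₁ v∈Pi | inj₁ v∈Pj = i≢j (prefix-shared⇒≡ v∈Pi v∈Pj)
      ... | inj₁ v∈Pi | inj₂ v∈Qj = i≢j (prefix-meets-partner v∈Pi v∈Qj)
      ... | inj₂ v∈Qi | inj₁ v∈Pj = i≢j (sym (prefix-meets-partner v∈Pj v∈Qi))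
      ... | inj₂ v∈Qi | inj₂ v∈Qj with suffix-shared⇒≡ v∈Qi v∈Qj
      ...   | same =
        i≢j (Continues-injective (subst (Continues i) same (proj₂ (partner i))) (proj₂ (partner j)))

  module Extend {G : Graph} {x y : V} {A B : V → Set} (M : Certificate G A B)
      (x∉S : x ∉ separator M) (y∉S : y ∉ separator M)
      (M₁ : Certificate G A (_∈ x ∷ separator M)) (M₂ : Certificate G (_∈ y ∷ separator M) B) where

    X-separates : Separates ((x , y) ∷ G) A B (x ∷ separator M)
    X-separates = separates-newArcˡ (here refl) (separates-⊆ there (separates M))

    Y-separates : Separates ((x , y) ∷ G) A B (y ∷ separator M)
    Y-separates = separates-newArcʳ (here refl) (separates-⊆ there (separates M))

    exceeds : ∀ {k} → k ≰ size M → suc (length (separator M)) ≤ k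
    exceeds k≰size = ≤-trans (s≤s (separator-size M)) (≰⇒> k≰size)

    certificate : Certificate ((x , y) ∷ G) A B
    certificate with size M₁ ≤? size M | size M₂ ≤? size M
    ... | yes k₁≤k | _ =
      keepPaths M (separator M₁) (≤-trans (separator-size M₁) k₁≤k)
        (separates-transˡ (here refl) X-separates (separates M₁))
    ... | no _ | yes k₂≤k =
      keepPaths M (separator M₂) (≤-trans (separator-size M₂) k₂≤k)
        (separates-transʳ (here refl) Y-separates (separates M₂))
    ... | no k₁≰k | no k₂≰k = record
      { size           = suc (length (separator M))
      ; paths          = Glue.gluedPaths x∉S y∉S (separates M)
                           (takePaths (exceeds k₁≰k) (paths M₁)) (takePaths (exceeds k₂≰k) (paths M₂))
      ; separator      = x ∷ separator M
      ; separator-size = ≤-refl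
      ; separates      = X-separates
      }

  -- Göring's proof, by induction on the arcs.
  menger : (G : Graph) → Decidable A → Decidable B → Certificate G A B
  menger {A} {B} [] A? B? = record
    { size = length Z ; paths = trivial , disjoint
    ; separator = Z ; separator-size = ≤-refl ; separates = Z-separates }
    where
    A∩B? : Decidable (λ v → A v × B v)
    A∩B? v = A? v ×-dec B? v
    Z : List V
    Z = filter A∩B? enum
    trivial : Fin (length Z) → Path [] A B
    trivial i = let v∈A , v∈B = proj₂ (∈-filter⁻ A∩B? {xs = enum} (∈-lookup i))
                in record { source∈A = v∈A ; target∈B = v∈B ; walk = ε }
    disjoint : ∀ {i j} → i ≢ j → Disjoint (verts (walk (trivial i))) (verts (walk (trivial j)))
    disjoint i≢j (here refl , here eq) = i≢j (Unique⇒lookup-injective (filter⁺ A∩B? enum-unique) eq)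
    Z-separates : Separates [] A B Z
    Z-separates a∈A b∈B ε        = here (∈-filter⁺ A∩B? (∈-enum _) (a∈A , b∈B))
    Z-separates a∈A b∈B (() ◅ _)
  menger ((x , y) ∷ G) A? B? with menger G A? B?
  ... | M with x ∈? separator M | y ∈? separator M
  ...   | yes x∈S | _       = keepPaths M _ (separator-size M) (separates-newArcˡ x∈S (separates M))
  ...   | no _    | yes y∈S = keepPaths M _ (separator-size M) (separates-newArcʳ y∈S (separates M))
  ...   | no x∉S  | no y∉S  =
    Extend.certificate M x∉S y∉S (menger G A? (_∈? x ∷ separator M)) (menger G (_∈? y ∷ separator M) B?)

-- The time-expanded graph of f

module TimeExpanded {n q p : ℕ} (D : Digraph n) (f : State q n → State q n) (f∈F : InF D q f) where

  Vertex : Set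
  Vertex = Fin (suc p) × Fin n

  layer : Vertex → ℕ
  layer = toℕ ∘ proj₁

  vertices : List Vertex
  vertices = cartesianProduct (allFin (suc p)) (allFin n)

  _≟ᵛ_ : DecidableEquality Vertex
  _≟ᵛ_ = ≡-dec _≟ᶠ_ _≟ᶠ_

  ∈-vertices : ∀ c → c ∈ vertices
  ∈-vertices (s , u) = ∈-cartesianProduct⁺ (∈-allFin s) (∈-allFin u)

  open import Data.List.Membership.DecPropositional _≟ᵛ_ using (_∈?_)
  open Menger _≟ᵛ_ vertices (cartesianProduct⁺ (allFin⁺ _) (allFin⁺ _)) ∈-vertices

  IsArc : Vertex × Vertex → Set
  IsArc ((s , u) , (t , v)) = toℕ t ≡ suc (toℕ s) × DependsOn f u v

  IsArc? : Decidable IsArc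
  IsArc? ((s , u) , (t , v)) = (toℕ t ℕ.≟ suc (toℕ s)) ×-dec DependsOn? f u v

  arcs : Graph
  arcs = filter IsArc? (cartesianProduct vertices vertices)

  arc⇒IsArc : ∀ {c d} → (c , d) ∈ arcs → IsArc (c , d)
  arc⇒IsArc = proj₂ ∘ ∈-filter⁻ IsArc? {xs = cartesianProduct vertices vertices}

  IsArc⇒arc : ∀ {c d} → IsArc (c , d) → (c , d) ∈ arcs
  IsArc⇒arc {c} {d} = ∈-filter⁺ IsArc? (∈-cartesianProduct⁺ (∈-vertices c) (∈-vertices d))

  Start End : Vertex → Set
  Start (s , _) = s ≡ fzero
  End   (s , _) = s ≡ fromℕ p

  Start? : Decidable Start
  Start? (s , _) = s ≟ᶠ fzero

  End? : Decidable End
  End? (s , _) = s ≟ᶠ fromℕ p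

  layer-at : ∀ {c d} (w : Walk arcs c d) j → j ≤ len w → layer (at w j) ≡ layer c + j
  layer-at ε       zero    _          = sym (+-identityʳ _)
  layer-at ε       (suc j) ()
  layer-at (_ ◅ w) zero    _          = sym (+-identityʳ _)
  layer-at {c} (_◅_ {j = b} e w) (suc j) (s≤s j≤len) = begin
    layer (at w j)       ≡⟨ layer-at w j j≤len ⟩
    layer b + j          ≡⟨ cong (_+ j) (proj₁ (arc⇒IsArc e)) ⟩
    suc (layer c + j)    ≡⟨ +-suc (layer c) j ⟨
    layer c + suc j      ∎
    where open ≡-Reasoning

  module _ (P : Path arcs Start End) where

    private
      w = walk P

    path-length : len w ≡ p
    path-length = begin
      len w                        ≡⟨ cong (λ s → toℕ s + len w) (source∈A P) ⟨
      layer (source P) + len w     ≡⟨ layer-at w (len w) ≤-refl ⟨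
      layer (at w (len w))         ≡⟨ cong layer (at-len w) ⟩
      layer (target P)             ≡⟨ cong toℕ (target∈B P) ⟩
      toℕ (fromℕ p)                ≡⟨ toℕ-fromℕ p ⟩
      p                            ∎
      where open ≡-Reasoning

    layer-at-path : ∀ j → j ≤ p → layer (at w j) ≡ j
    layer-at-path j j≤p =
      trans (layer-at w j (subst (j ≤_) (sym path-length) j≤p)) (cong (λ s → toℕ s + j) (source∈A P))

    pWalk : Fin (suc p) → Fin n
    pWalk s = proj₂ (at w (toℕ s))

    pWalk-IsWalk : IsWalk D p pWalk
    pWalk-IsWalk s rewrite toℕ-inject₁ s =
      f∈F _ _ (proj₂ (arc⇒IsArc (at-arc w (toℕ s) (subst (suc (toℕ s) ≤_) (sym path-length) (toℕ<n s)))))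

  paths⇒IndepFamily : ∀ {m} → DisjointPaths arcs Start End m → IndepFamily D p m
  paths⇒IndepFamily W@(paths , _) = (λ i → pWalk (paths i)) , (λ i → pWalk-IsWalk (paths i)) , independent
    where
    independent : ∀ i j → i ≢ j → Independent (pWalk (paths i)) (pWalk (paths j))
    independent i j i≢j s same-u =
      i≢j (shared⇒≡ W (at∈verts _ (toℕ s)) (subst (_∈ _) (sym same-vertex) (at∈verts _ (toℕ s))))
      where
      layer-s : ∀ k → layer (at (walk (paths k)) (toℕ s)) ≡ toℕ s
      layer-s k = layer-at-path (paths k) (toℕ s) (toℕ≤pred[n] s)
      same-vertex : at (walk (paths i)) (toℕ s) ≡ at (walk (paths j)) (toℕ s)
      same-vertex = cong₂ _,_ (toℕ-injective (trans (layer-s i) (sym (layer-s j)))) same-u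

  value : State q n → Vertex → Fin q
  value x (s , u) = lookup (iter (toℕ s) f x) u

  trace : (Z : List Vertex) → State q n → Vec (Fin q) (length Z)
  trace []      x = []
  trace (z ∷ Z) x = value x z ∷ trace Z x

  trace-agree : ∀ Z {x y} → trace Z x ≡ trace Z y → ∀ {z} → z ∈ Z → value x z ≡ value y z
  trace-agree (z ∷ Z) eq (here refl) = cong head eq
  trace-agree (z ∷ Z) eq (there z∈) = trace-agree Z (cong tail eq) z∈

  module _ (Z : List Vertex) {x y : State q n} (agree : ∀ {z} → z ∈ Z → value x z ≡ value y z) where

    Blocked : Vertex → Set
    Blocked d = ∀ {c} → Start c → (w : Walk arcs c d) → Any (_∈ Z) (verts w)

    blocked-predecessor : ∀ {c d} → Blocked d → d ∉ Z → (c , d) ∈ arcs → Blocked c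
    blocked-predecessor blocked d∉Z e c-starts w = Any-verts-snoc w e (blocked c-starts (w ◅◅ e ◅ ε)) d∉Z

    blocked⇒agree : ∀ j {s u} → toℕ s ≡ j → Blocked (s , u) → value x (s , u) ≡ value y (s , u)
    blocked⇒agree j {s} {u} _ blocked with (s , u) ∈? Z
    ... | yes d∈Z = agree d∈Z
    blocked⇒agree j {fzero} _ blocked | no d∉Z with blocked refl ε
    ... | here d∈Z = ⊥-elim (d∉Z d∈Z)
    blocked⇒agree zero    {fsuc t} () blocked | no d∉Z
    blocked⇒agree (suc j) {fsuc t} {v} s≡j blocked | no d∉Z = dependencies-determine f v _ _ λ u u→v →
      subst (λ k → lookup (iter k f x) u ≡ lookup (iter k f y) u) (toℕ-inject₁ t)
        (blocked⇒agree j (trans (toℕ-inject₁ t) (suc-injective s≡j))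
          (blocked-predecessor blocked d∉Z (IsArc⇒arc (cong suc (sym (toℕ-inject₁ t)) , u→v))))

  separator-determines : ∀ {Z} → Separates arcs Start End Z →
    ∀ {x y} → trace Z x ≡ trace Z y → iter p f x ≡ iter p f y
  separator-determines {Z} separates {x} {y} eq = lookup-ext _ _ λ u →
    subst (λ k → lookup (iter k f x) u ≡ lookup (iter k f y) u) (toℕ-fromℕ p)
      (blocked⇒agree Z (trace-agree Z eq) p (toℕ-fromℕ p) (λ c-starts → separates c-starts refl))

  open Certificate (menger arcs Start? End?) public

lemma1 : ∀ (n : ℕ) (D : Digraph n) (q p : ℕ) → 2 ≤ q → 1 ≤ p →
    (f : State q n → State q n) → InF D q f →
    ∀ (k c : ℕ) → IsAlpha D p k → ImCard (iter p f) c → c ≤ q ^ k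
lemma1 n D q p 2≤q _ f f∈F k c (_ , maximal) image = begin
  c                    ≤⟨ ImCard≤^ (trace separator) (separator-determines separates) image ⟩
  q ^ length separator ≤⟨ ^-monoʳ-≤ q {{>-nonZero (≤-trans (s≤s z≤n) 2≤q)}} separator≤k ⟩
  q ^ k                ∎
  where
  open ≤-Reasoning
  open TimeExpanded {p = p} D f f∈F
  separator≤k : length separator ≤ k
  separator≤k = ≤-trans separator-size (maximal size (paths⇒IndepFamily paths))
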